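{- Let $R$ be a ring and let $N$ be a nilpotent ideal of $R$ of nilpotency index $t \geq 2$ (i.e. $N^t=\{0\}$). Then: (1) For every prime number $p$ with $p \geq t$ and every $n \in N$, there exists $r \in R$ such that $(1+n)^p = 1 + pnr$. (2) Let $w$ be a natural number and let $\bar f = f+N \in R/N$ satisfy $\bar f^{\,w} = \bar 1$. Suppose there exists a natural number $s>1$ such that $sN=\{0\}$ and every prime factor of $s$ is greater than or equal to $t$. Then $g^{ws}=1$ for every $g \in f+N$. Moreover, if $w$ is the multiplicative order of $\bar f$ in $R/N$, then for every $g\in f+N$ the multiplicative order of $g$ in $R$ divides $ws$.
   Context: Rings are associative with identity $1$, not necessarily commutative. An element $x$ of a ring has finite multiplicative order if $x^m=1$ for some natural number $m\geq 1$; the least such $m$ is the multiplicative order $o(x)$ of $x$. -}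

module Defs where

open import Level using (Level; _⊔_)
open import Data.Nat.Base using (ℕ; _≤_; _<_)
open import Data.Fin.Base using (Fin)
open import Data.Product.Base renaming (_×_ to _∧_)
open import Algebra.Bundles using (Ring)
open import Algebra.Bundles using (Semiring)
import Algebra.Definitions.RawSemiring as RSDefs

module _ {c ℓ : Level} (R : Ring c ℓ) where
  open Ring R
  open RSDefs (Semiring.rawSemiring semiring) using (product; _^_; _×_)

  pow : Carrier → ℕ → Carrier
  pow x n = x ^ n

  times : ℕ → Carrier → Carrier
  times n x = n × x

  record IsIdeal {ℓ' : Level} (N : Carrier → Set ℓ') : Set (c ⊔ ℓ ⊔ ℓ') where
    field
      resp   : ∀ {x y} → x ≈ y → N x → N y
      zero∈  : N 0#
      +-closed : ∀ {x y} → N x → N y → N (x + y)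
      neg-closed : ∀ {x} → N x → N (- x)
      *ˡ-closed : ∀ r {x} → N x → N (r * x)
      *ʳ-closed : ∀ r {x} → N x → N (x * r)

  -- N^t = {0}: the ideal N^t is additively generated by the products
  -- n₁ n₂ ⋯ nₜ with all nᵢ ∈ N, so N^t = {0} iff all such products vanish.
  PowerZero : {ℓ' : Level} → (Carrier → Set ℓ') → ℕ → Set (c ⊔ ℓ ⊔ ℓ')
  PowerZero N t = (v : Fin t → Carrier) → (∀ i → N (v i)) → product v ≈ 0#

  IsMulOrder : Carrier → ℕ → Set ℓ
  IsMulOrder x m = 1 ≤ m ∧ x ^ m ≈ 1# ∧ (∀ k → 1 ≤ k → x ^ k ≈ 1# → m ≤ k)

  -- m is the multiplicative order of x + N in R/N
  -- (x̄ ^ k = 1̄ in R/N  iff  x ^ k - 1 ∈ N).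
  IsMulOrderMod : {ℓ' : Level} → (Carrier → Set ℓ') → Carrier → ℕ → Set ℓ'
  IsMulOrderMod N x m =
    1 ≤ m ∧ N (x ^ m - 1#) ∧ (∀ k → 1 ≤ k → N (x ^ k - 1#) → m ≤ k)

-- Since p is prime, p divides every inner binomial coefficient of
-- (1 + n)^p, while the last term n^p vanishes once p ≥ t; this gives (1).
-- Iterating (1) along the prime factorisation of s yields
-- (1 + n)^s = 1 + s n r for n ∈ N, which is 1 when sN = 0. For g ∈ f + N
-- we have g^w ∈ 1 + N because reduction modulo N is multiplicative, so
-- g^(ws) = (g^w)^s = 1, and the order of g divides ws.
{-# OPTIONS --safe #-}
module Submission where

open import Defs
open import Level using (Level)
open import Data.Nat.Base as ℕ
  using (ℕ; zero; suc; NonZero; _≤_; _<_; _∸_; _!; z<s; s<s; >-nonZero)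
  renaming (_*_ to _*ℕ_)
import Data.Nat.Properties as ℕ
open import Data.Nat.Divisibility using (_∣_; ∣⇒≤; ∣1⇒≡1; m∣m*n; m%n≡0⇒n∣m)
open import Data.Nat.DivMod using (_/_; _%_; m*[n/m]≡n; m/n*n≡m; m%n<n; m≡m%n+[m/n]*n)
open import Data.Nat.Primality
  using (Prime; euclidsLemma; prime⇒nonZero; prime⇒nonTrivial)
open import Data.Nat.Primality.Factorisation using (factorise; PrimeFactorisation)
open import Data.Nat.Combinatorics
  using (_C_; nCk≡n!/k![n-k]!; k![n∸k]!∣n!)
import Data.Nat.ListAction as ℕ
open import Data.Nat.ListAction.Properties using (∈⇒∣product)
open import Data.Fin.Base using (Fin; toℕ) renaming (zero to fzero; suc to fsuc)
open import Data.Fin.Properties using (toℕ<n)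
open import Data.List.Base using ([]; _∷_)
open import Data.List.Relation.Unary.All as All using (All; []; _∷_)
open import Data.Product.Base using (∃; _,_)
open import Data.Sum.Base using (inj₁; inj₂)
open import Data.Empty using (⊥-elim)
open import Algebra.Bundles using (Ring; Semiring)
import Algebra.Properties.Semiring.Binomial as Binomial
open import Relation.Binary.PropositionalEquality as ≡ using (_≡_)
open import Relation.Nullary using (contradiction)

prime∣n!⇒p≤n : ∀ {p} → Prime p → ∀ n → p ∣ n ! → p ≤ n
prime∣n!⇒p≤n p-prime zero p∣1 with ∣1⇒≡1 p∣1
... | ≡.refl = ⊥-elim (ℕ.NonTrivial.nonTrivial (prime⇒nonTrivial p-prime))
prime∣n!⇒p≤n p-prime (suc n) p∣n! with euclidsLemma (suc n) (n !) p-prime p∣n!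
... | inj₁ p∣1+n = ∣⇒≤ p∣1+n
... | inj₂ p∣n!′ = ℕ.m≤n⇒m≤1+n (prime∣n!⇒p≤n p-prime n p∣n!′)

prime∣pCk : ∀ {p k} → Prime p → 0 < k → k < p → p ∣ p C k
prime∣pCk {p} {k} p-prime 0<k k<p
  with euclidsLemma (p C k) (k ! *ℕ (p ∸ k) !) p-prime p∣pCk*k!*[p∸k]!
  where
  instance _ = k ℕ.!* (p ∸ k) !≢0
  instance _ = prime⇒nonZero p-prime
  p∣pCk*k!*[p∸k]! : p ∣ (p C k) *ℕ (k ! *ℕ (p ∸ k) !)
  p∣pCk*k!*[p∸k]! = ≡.subst (p ∣_) (≡.sym p!≡pCk*k!*[p∸k]!) (p∣p! p)
    where
    p!≡pCk*k!*[p∸k]! : (p C k) *ℕ (k ! *ℕ (p ∸ k) !) ≡ p !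
    p!≡pCk*k!*[p∸k]! = ≡.trans
      (≡.cong (_*ℕ (k ! *ℕ (p ∸ k) !)) (nCk≡n!/k![n-k]! (ℕ.<⇒≤ k<p)))
      (m/n*n≡m (k![n∸k]!∣n! (ℕ.<⇒≤ k<p)))
    p∣p! : ∀ n → .{{NonZero n}} → n ∣ n !
    p∣p! (suc n) = m∣m*n (n !)
... | inj₁ p∣pCk = p∣pCk
... | inj₂ p∣k!*[p∸k]! with euclidsLemma (k !) ((p ∸ k) !) p-prime p∣k!*[p∸k]!
...   | inj₁ p∣k! = contradiction (prime∣n!⇒p≤n p-prime k p∣k!) (ℕ.<⇒≱ k<p)
...   | inj₂ p∣[p∸k]! = contradiction (prime∣n!⇒p≤n p-prime (p ∸ k) p∣[p∸k]!)
                                     (ℕ.<⇒≱ (ℕ.∸-monoʳ-< 0<k (ℕ.<⇒≤ k<p)))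

module _ {a ℓ} (S : Semiring a ℓ) where
  open Semiring S
  open import Algebra.Properties.Semiring.Exp S using (_^_; ^-congˡ)
  open import Algebra.Properties.Semiring.Mult S
  open import Algebra.Properties.Semiring.Sum S using (sum; sum-cong-≋; *-distribˡ-sum)
  open import Relation.Binary.Reasoning.Setoid setoid

  1#^n≈1# : ∀ n → 1# ^ n ≈ 1#
  1#^n≈1# zero    = refl
  1#^n≈1# (suc n) = trans (*-identityˡ _) (1#^n≈1# n)

  n×0#≈0# : ∀ n → n × 0# ≈ 0#
  n×0#≈0# zero    = refl
  n×0#≈0# (suc n) = trans (+-identityˡ _) (n×0#≈0# n)

  n×x≈[n×1#]*x : ∀ n x → n × x ≈ (n × 1#) * x
  n×x≈[n×1#]*x n x = sym (trans (×-assoc-* n 1# x) (×-congʳ n (*-identityˡ x)))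

  module _ {p} (p-prime : Prime p) {x} (x^p≈0 : x ^ p ≈ 0#) where
    private
      instance _ = prime⇒nonZero p-prime
      module B = Binomial S x 1#

      pCk×x^k≈p×[pCk/p×x^k] : ∀ k → 0 < k → k ≤ p →
        (p C k) × x ^ k ≈ p × (((p C k) / p) × x ^ k)
      pCk×x^k≈p×[pCk/p×x^k] k 0<k k≤p with ℕ.m≤n⇒m<n∨m≡n k≤p
      ... | inj₁ k<p = begin
        (p C k) × x ^ k                ≈⟨ ×-congˡ (m*[n/m]≡n (prime∣pCk p-prime 0<k k<p)) ⟨
        (p *ℕ ((p C k) / p)) × x ^ k   ≈⟨ ×-assocˡ (x ^ k) p ((p C k) / p) ⟨
        p × (((p C k) / p) × x ^ k)    ∎
      ... | inj₂ ≡.refl = begin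
        (p C p) × x ^ p                ≈⟨ ×-congʳ (p C p) x^p≈0 ⟩
        (p C p) × 0#                   ≈⟨ n×0#≈0# (p C p) ⟩
        0#                             ≈⟨ n×0#≈0# p ⟨
        p × 0#                         ≈⟨ ×-congʳ p (trans (×-congʳ q x^p≈0) (n×0#≈0# q)) ⟨
        p × (((p C p) / p) × x ^ p)    ∎
        where q = (p C p) / p

      cofactor : Fin p → Carrier
      cofactor i = ((p C suc (toℕ i)) / p) × x ^ toℕ i

      binomialTerm≈p×[x*cofactor] : ∀ i → B.binomialTerm p (fsuc i) ≈ p × (x * cofactor i)
      binomialTerm≈p×[x*cofactor] i = begin
        (p C k) × (x ^ k * 1# ^ (p ∸ k))   ≈⟨ ×-congʳ (p C k) (trans (*-congˡ (1#^n≈1# (p ∸ k))) (*-identityʳ _)) ⟩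
        (p C k) × x ^ k                    ≈⟨ pCk×x^k≈p×[pCk/p×x^k] k z<s (toℕ<n i) ⟩
        p × (((p C k) / p) × (x * x ^ j))  ≈⟨ ×-congʳ p (×-comm-* ((p C k) / p) x (x ^ j)) ⟨
        p × (x * cofactor i)              ∎
        where
        j = toℕ i
        k = suc j

      binomialTerm₀≈1# : B.binomialTerm p fzero ≈ 1#
      binomialTerm₀≈1# = trans (+-identityʳ _) (trans (*-identityˡ _) (1#^n≈1# p))

    [1+x]^p≈1+p×[x*r] : ∃ λ r → (1# + x) ^ p ≈ 1# + p × (x * r)
    [1+x]^p≈1+p×[x*r] = sum cofactor , (begin
      (1# + x) ^ p                           ≈⟨ ^-congˡ p (+-comm 1# x) ⟩
      (x + 1#) ^ p                           ≈⟨ B.theorem (trans (*-identityʳ x) (sym (*-identityˡ x))) p ⟩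
      B.binomialExpansion p                  ≈⟨ +-cong binomialTerm₀≈1# (sum-cong-≋ binomialTerm≈p×[x*cofactor]) ⟩
      1# + sum (λ i → p × (x * cofactor i)) ≈⟨ +-congˡ (sum-cong-≋ λ i → n×x≈[n×1#]*x p (x * cofactor i)) ⟩
      1# + sum (λ i → P * (x * cofactor i)) ≈⟨ +-congˡ (*-distribˡ-sum P (λ i → x * cofactor i)) ⟨
      1# + P * sum (λ i → x * cofactor i)   ≈⟨ +-congˡ (*-congˡ (*-distribˡ-sum x cofactor)) ⟨
      1# + P * (x * sum cofactor)           ≈⟨ +-congˡ (n×x≈[n×1#]*x p (x * sum cofactor)) ⟨
      1# + p × (x * sum cofactor)           ∎)
      where
      P = p × 1#

module _ {c ℓ} (R : Ring c ℓ) where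
  open Ring R
  open import Algebra.Properties.Ring R using (x[y-z]≈xy-xz; [y-z]x≈yx-zx; //-rightDividesˡ)
  open import Algebra.Properties.Semiring.Exp semiring using (_^_; ^-congˡ; ^-congʳ; ^-homo-*; ^-assocʳ)
  open import Algebra.Properties.Semiring.Mult semiring using (_×_; ×-congʳ; ×-assocˡ; ×-assoc-*)
  open import Algebra.Definitions.RawSemiring (Semiring.rawSemiring semiring) using (product)
  open import Relation.Binary.Reasoning.Setoid setoid

  [x-y]+[y-z]≈x-z : ∀ x y z → (x - y) + (y - z) ≈ x - z
  [x-y]+[y-z]≈x-z x y z = trans (sym (+-assoc _ _ _)) (+-congʳ (//-rightDividesˡ y x))

  1+[x-1]≈x : ∀ x → 1# + (x - 1#) ≈ x
  1+[x-1]≈x x = trans (+-comm _ _) (//-rightDividesˡ 1# x)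

  xu-yv≈x[u-v]+[x-y]v : ∀ x y u v → x * u - y * v ≈ x * (u - v) + (x - y) * v
  xu-yv≈x[u-v]+[x-y]v x y u v = sym (begin
    x * (u - v) + (x - y) * v              ≈⟨ +-cong (x[y-z]≈xy-xz x u v) ([y-z]x≈yx-zx v x y) ⟩
    (x * u - x * v) + (x * v - y * v)      ≈⟨ [x-y]+[y-z]≈x-z (x * u) (x * v) (y * v) ⟩
    x * u - y * v                          ∎)

  IsMulOrder⇒∣ : ∀ {g m n} → IsMulOrder R g m → g ^ n ≈ 1# → m ∣ n
  IsMulOrder⇒∣ {g} {m@(suc _)} {n} (_ , g^m≈1 , minimal) g^n≈1 with n % m in n%m≡r
  ... | zero  = m%n≡0⇒n∣m n m n%m≡r
  ... | suc r = ⊥-elim (ℕ.<⇒≱ (≡.subst (_< m) n%m≡r (m%n<n n m)) (minimal (suc r) (s<s ℕ.z≤n) g^[1+r]≈1))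
    where
    g^[1+r]≈1 : g ^ suc r ≈ 1#
    g^[1+r]≈1 = begin
      g ^ suc r                       ≈⟨ trans (*-congˡ (1#^n≈1# semiring (n / m))) (*-identityʳ _) ⟨
      g ^ suc r * 1# ^ (n / m)        ≈⟨ *-congˡ (^-congˡ (n / m) g^m≈1) ⟨
      g ^ suc r * (g ^ m) ^ (n / m)   ≈⟨ *-congˡ (trans (^-assocʳ g m (n / m)) (^-congʳ g (ℕ.*-comm m (n / m)))) ⟩
      g ^ suc r * g ^ (n / m *ℕ m)    ≈⟨ ^-homo-* g (suc r) (n / m *ℕ m) ⟨
      g ^ (suc r ℕ.+ n / m *ℕ m)      ≈⟨ ^-congʳ g (≡.trans (≡.cong (ℕ._+ n / m *ℕ m) (≡.sym n%m≡r)) (≡.sym (m≡m%n+[m/n]*n n m))) ⟩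
      g ^ n                           ≈⟨ g^n≈1 ⟩
      1#                              ∎

  module _ {ℓ'} {N : Carrier → Set ℓ'} (N-ideal : IsIdeal R N) where
    open IsIdeal N-ideal

    ×-closed : ∀ k {x} → N x → N (k × x)
    ×-closed zero    _   = zero∈
    ×-closed (suc k) x∈N = +-closed x∈N (×-closed k x∈N)

    infix 4 _≡_mod-N
    _≡_mod-N : Carrier → Carrier → Set ℓ'
    x ≡ y mod-N = N (x - y)

    ≡-mod-refl : ∀ x → x ≡ x mod-N
    ≡-mod-refl x = resp (sym (-‿inverseʳ x)) zero∈

    ≡-mod-trans : ∀ {x y z} → x ≡ y mod-N → y ≡ z mod-N → x ≡ z mod-N
    ≡-mod-trans x≡y y≡z = resp ([x-y]+[y-z]≈x-z _ _ _) (+-closed x≡y y≡z)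

    ≡-mod-*-cong : ∀ {x y u v} → x ≡ y mod-N → u ≡ v mod-N → x * u ≡ y * v mod-N
    ≡-mod-*-cong {x} {y} {u} {v} x≡y u≡v =
      resp (sym (xu-yv≈x[u-v]+[x-y]v x y u v)) (+-closed (*ˡ-closed x u≡v) (*ʳ-closed v x≡y))

    ≡-mod-^-cong : ∀ {x y} → x ≡ y mod-N → ∀ k → x ^ k ≡ y ^ k mod-N
    ≡-mod-^-cong x≡y zero    = ≡-mod-refl 1#
    ≡-mod-^-cong x≡y (suc k) = ≡-mod-*-cong x≡y (≡-mod-^-cong x≡y k)

    module _ {t} (N^t≈0 : PowerZero R N t) where

      ^-nilpotent : ∀ {x} → N x → ∀ {m} → t ≤ m → x ^ m ≈ 0#
      ^-nilpotent {x} x∈N {m} t≤m = begin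
        x ^ m                 ≈⟨ ^-congʳ x (≡.sym (ℕ.m∸n+n≡m t≤m)) ⟩
        x ^ (m ∸ t ℕ.+ t)     ≈⟨ ^-homo-* x (m ∸ t) t ⟩
        x ^ (m ∸ t) * x ^ t   ≈⟨ *-congˡ (trans (sym (product-const t)) (N^t≈0 (λ _ → x) (λ _ → x∈N))) ⟩
        x ^ (m ∸ t) * 0#      ≈⟨ zeroʳ _ ⟩
        0#                    ∎
        where
        product-const : ∀ k → product {k} (λ _ → x) ≈ x ^ k
        product-const zero    = refl
        product-const (suc k) = *-congˡ (product-const k)

      [1+n]^p≈1+p×[n*r] : ∀ {p} → Prime p → t ≤ p → ∀ {n} → N n →
        ∃ λ r → (1# + n) ^ p ≈ 1# + p × (n * r)
      [1+n]^p≈1+p×[n*r] p-prime t≤p n∈N =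
        [1+x]^p≈1+p×[x*r] semiring p-prime (^-nilpotent n∈N t≤p)

      [1+n]^∏ps≈1+∏ps×[n*r] : ∀ {ps} → All Prime ps → All (t ≤_) ps → ∀ {n} → N n →
        ∃ λ r → (1# + n) ^ ℕ.product ps ≈ 1# + ℕ.product ps × (n * r)
      [1+n]^∏ps≈1+∏ps×[n*r] [] [] {n} _ =
        1# , trans (*-identityʳ _) (+-congˡ (sym (trans (+-identityʳ _) (*-identityʳ n))))
      [1+n]^∏ps≈1+∏ps×[n*r] {q ∷ ps} (q-prime ∷ ps-prime) (t≤q ∷ t≤ps) {n} n∈N
        with [1+n]^∏ps≈1+∏ps×[n*r] ps-prime t≤ps n∈N
      ... | r , [1+n]^P≈1+v
        with [1+n]^p≈1+p×[n*r] q-prime t≤q (×-closed (ℕ.product ps) (*ʳ-closed r n∈N))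
      ... | r′ , [1+v]^q≈1+q×[v*r′] = r * r′ , (begin
        (1# + n) ^ (q *ℕ P)                ≈⟨ ^-congʳ (1# + n) (ℕ.*-comm q P) ⟩
        (1# + n) ^ (P *ℕ q)                ≈⟨ ^-assocʳ (1# + n) P q ⟨
        ((1# + n) ^ P) ^ q                 ≈⟨ ^-congˡ q [1+n]^P≈1+v ⟩
        (1# + P × (n * r)) ^ q             ≈⟨ [1+v]^q≈1+q×[v*r′] ⟩
        1# + q × (P × (n * r) * r′)        ≈⟨ +-congˡ (×-congʳ q (×-assoc-* P (n * r) r′)) ⟩
        1# + q × (P × (n * r * r′))        ≈⟨ +-congˡ (×-assocˡ (n * r * r′) q P) ⟩
        1# + (q *ℕ P) × (n * r * r′)       ≈⟨ +-congˡ (×-congʳ (q *ℕ P) (*-assoc n r r′)) ⟩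
        1# + (q *ℕ P) × (n * (r * r′))     ∎)
        where P = ℕ.product ps

      [1+n]^s≈1+s×[n*r] : ∀ s .{{_ : NonZero s}} → (∀ q → Prime q → q ∣ s → t ≤ q) →
        ∀ {n} → N n → ∃ λ r → (1# + n) ^ s ≈ 1# + s × (n * r)
      [1+n]^s≈1+s×[n*r] s s-rough {n} n∈N =
        ≡.subst (λ k → ∃ λ r → (1# + n) ^ k ≈ 1# + k × (n * r)) (≡.sym isFactorisation)
          ([1+n]^∏ps≈1+∏ps×[n*r] factorsPrime t≤factors n∈N)
        where
        open PrimeFactorisation (factorise s)
        t≤factors : All (t ≤_) factors
        t≤factors = All.tabulate λ {q} q∈factors →
          s-rough q (All.lookup factorsPrime q∈factors)
            (≡.subst (q ∣_) (≡.sym isFactorisation) (∈⇒∣product q∈factors))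

      ^[w*s]≈1 : ∀ w s .{{_ : NonZero s}} → (∀ q → Prime q → q ∣ s → t ≤ q) →
        (∀ n → N n → s × n ≈ 0#) → ∀ {f} → f ^ w ≡ 1# mod-N →
        ∀ {g} → g ≡ f mod-N → g ^ (w *ℕ s) ≈ 1#
      ^[w*s]≈1 w s s-rough sN≈0 f^w≡1 {g} g≡f =
        let r , [1+u]^s≈1+s×[u*r] = [1+n]^s≈1+s×[n*r] s s-rough g^w≡1 in begin
        g ^ (w *ℕ s)                   ≈⟨ ^-assocʳ g w s ⟨
        (g ^ w) ^ s                    ≈⟨ ^-congˡ s (1+[x-1]≈x (g ^ w)) ⟨
        (1# + (g ^ w - 1#)) ^ s        ≈⟨ [1+u]^s≈1+s×[u*r] ⟩
        1# + s × ((g ^ w - 1#) * r)    ≈⟨ +-congˡ (sN≈0 _ (*ʳ-closed r g^w≡1)) ⟩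
        1# + 0#                        ≈⟨ +-identityʳ 1# ⟩
        1#                             ∎
        where
        g^w≡1 : g ^ w ≡ 1# mod-N
        g^w≡1 = ≡-mod-trans (≡-mod-^-cong g≡f w) f^w≡1

open import Data.Product.Base using (_×_)

proposition3p1 : ∀ {c ℓ ℓ' : Level} (R : Ring c ℓ) (N : Ring.Carrier R → Set ℓ') →
    IsIdeal R N → (t : ℕ) → 2 ≤ t → PowerZero R N t →
    let open Ring R in
    -- (1)
    (∀ (p : ℕ) → Prime p → t ≤ p → ∀ n → N n →
      ∃ λ r → pow R (1# + n) p ≈ 1# + times R p (n * r))
    ×
    -- (2)
    (∀ (w : ℕ) (f : Carrier) → N (pow R f w - 1#) →
      ∀ (s : ℕ) → 1 < s → (∀ n → N n → times R s n ≈ 0#) →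
      (∀ q → Prime q → q ∣ s → t ≤ q) →
      (∀ g → N (g - f) → pow R g (w *ℕ s) ≈ 1#)
      ×
      (IsMulOrderMod R N f w →
        ∀ g → N (g - f) → ∀ m → IsMulOrder R g m → m ∣ w *ℕ s))
proposition3p1 R N N-ideal t _ N^t≈0 =
  (λ p p-prime t≤p n n∈N → [1+n]^p≈1+p×[n*r] R N-ideal N^t≈0 p-prime t≤p n∈N) ,
  λ w f f^w≡1 s s>1 sN≈0 s-rough →
    let instance _ = >-nonZero (ℕ.<-trans z<s s>1)
        g^ws≈1 = λ g g≡f → ^[w*s]≈1 R N-ideal N^t≈0 w s s-rough sN≈0 f^w≡1 g≡f
    in g^ws≈1 , λ _ g g≡f m order → IsMulOrder⇒∣ R order (g^ws≈1 g g≡f)
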